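{- For every integer $n \geq 1$, $\sigma(K_{1,n} \boxtimes K_{1,n}) \geq n + 1$, where $K_{1,n}$ is the star with $n$ leaves.
   Context: Surrounding Cops and Robbers on a finite simple graph $G$ with $k \geq 1$ cops and one robber: the cops first choose starting vertices (several cops may share a vertex), then the robber chooses a starting vertex not occupied by a cop, and thereafter the cops and the robber alternate moves, the cops moving first. In a move, each player may move to an adjacent vertex or stay put; the robber may never move to, or remain on, a vertex occupied by a cop, so if a cop moves onto the robber's vertex the robber is compelled to move to a neighbouring vertex not occupied by a cop. The cops win if at any time every neighbour of the robber's vertex is occupied by a cop; the robber wins if he avoids this forever. Play is with perfect information. The surrounding cop number $\sigma(G)$ is the least number of cops for which the cops have a winning strategy. The strong product $G \boxtimes H$ has vertex set $V(G)\times V(H)$, with distinct $(g,h)$ and $(g',h')$ adjacent iff ($g=g'$ or $gg'\in E(G)$) and ($h=h'$ or $hh'\in E(H)$). -}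

module Defs where

open import Data.Nat using (ℕ; zero; suc)
open import Data.Fin using (Fin; zero; suc)
open import Data.Product using (Σ; ∃; _×_; _,_; proj₁; proj₂)
open import Data.Sum using (_⊎_; inj₁; inj₂)
open import Data.Vec using (Vec; []; _∷_; head)
open import Relation.Nullary using (¬_)
open import Relation.Binary.PropositionalEquality using (_≡_; refl; sym)

record Graph : Set₁ where
  field
    V          : Set
    Adj        : V → V → Set
    Adj-sym    : ∀ {x y} → Adj x y → Adj y x
    Adj-irrefl : ∀ {x} → ¬ Adj x x

-- The star K_{1,n}: vertex set Fin (suc n), centre = zero, leaves = suc i.

StarAdj : ∀ {n} → Fin (suc n) → Fin (suc n) → Set
StarAdj a b = (a ≡ zero × ¬ b ≡ zero) ⊎ (¬ a ≡ zero × b ≡ zero)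

Star : ℕ → Graph
Star n = record
  { V = Fin (suc n)
  ; Adj = StarAdj
  ; Adj-sym = λ { (inj₁ (p , q)) → inj₂ (q , p) ; (inj₂ (p , q)) → inj₁ (q , p) }
  ; Adj-irrefl = λ { (inj₁ (p , q)) → q p ; (inj₂ (p , q)) → p q }
  }

module _ (G H : Graph) where
  private
    module G = Graph G
    module H = Graph H

  SPAdj : G.V × H.V → G.V × H.V → Set
  SPAdj (g , h) (g' , h') =
    ¬ (g , h) ≡ (g' , h') × (g ≡ g' ⊎ G.Adj g g') × (h ≡ h' ⊎ H.Adj h h')

  private
    symEq : ∀ {A : Set} (R : A → A → Set) → (∀ {x y} → R x y → R y x) →
            ∀ {x y} → (x ≡ y ⊎ R x y) → (y ≡ x ⊎ R y x)
    symEq R s (inj₁ e) = inj₁ (sym e)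
    symEq R s (inj₂ r) = inj₂ (s r)

    spSym : ∀ {x y} → SPAdj x y → SPAdj y x
    spSym (ne , a , b) = (λ e → ne (sym e)) , symEq G.Adj G.Adj-sym a , symEq H.Adj H.Adj-sym b

  StrongProduct : Graph
  StrongProduct = record
    { V = G.V × H.V
    ; Adj = SPAdj
    ; Adj-sym = spSym
    ; Adj-irrefl = λ { (ne , _ , _) → ne refl }
    }

-- A history after t rounds is the list of states (cop positions, robber
-- position) after each completed round, most recent first.  Round 0:
-- cops place, robber places.  Round t+1: cops move, then robber moves.

module Game (G : Graph) (k : ℕ) where
  open Graph G

  Cops : Set
  Cops = Fin k → V

  Occupied : Cops → V → Set
  Occupied c v = ∃ λ (i : Fin k) → c i ≡ v

  Surrounded : Cops → V → Set
  Surrounded c r = ∀ v → Adj r v → Occupied c v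

  StepOrStay : V → V → Set
  StepOrStay x y = x ≡ y ⊎ Adj x y

  History : ℕ → Set
  History t = Vec (Cops × V) (suc t)

  record CopStrategy : Set where
    field
      start      : Cops
      move       : ∀ {t} → History t → Cops
      move-legal : ∀ {t} (h : History t) (i : Fin k) →
                   StepOrStay (proj₁ (head h) i) (move h i)

  -- The robber sees the history and the cops' new positions.  His move
  -- must be legal unless the game is already over (he is surrounded).
  record RobberStrategy : Set where
    field
      start       : Cops → V
      start-legal : ∀ c → ¬ Occupied c (start c)
      move        : ∀ {t} → History t → Cops → V
      move-legal  : ∀ {t} (h : History t) (c : Cops) →
                    Surrounded c (proj₂ (head h))
                    ⊎ (StepOrStay (proj₂ (head h)) (move h c) × ¬ Occupied c (move h c))

  play : CopStrategy → RobberStrategy → (t : ℕ) → History t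
  play σc σr zero = (CopStrategy.start σc , RobberStrategy.start σr (CopStrategy.start σc)) ∷ []
  play σc σr (suc t) =
    let h = play σc σr t
        c = CopStrategy.move σc h
    in (c , RobberStrategy.move σr h c) ∷ h

  copsAt : CopStrategy → RobberStrategy → ℕ → Cops
  copsAt σc σr t = proj₁ (head (play σc σr t))

  robberAt : CopStrategy → RobberStrategy → ℕ → V
  robberAt σc σr t = proj₂ (head (play σc σr t))

  -- the robber is surrounded at some moment: after the robber's move
  -- (or placement) in round t, or after the cops' move in round t+1
  Captured : CopStrategy → RobberStrategy → Set
  Captured σc σr = ∃ λ (t : ℕ) →
    Surrounded (copsAt σc σr t) (robberAt σc σr t)
    ⊎ Surrounded (copsAt σc σr (suc t)) (robberAt σc σr t)

  CopsWin : Set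
  CopsWin = Σ CopStrategy λ σc → (σr : RobberStrategy) → Captured σc σr

open Game public using (CopsWin)

open import Data.Nat using (_≤_; _<_)

SurroundingCopNumber≥ : Graph → ℕ → Set
SurroundingCopNumber≥ G m = ∀ k → 1 ≤ k → k < m → ¬ CopsWin G k

module Submission where

-- The robber lives on the "cross" C = {(a , b) | a = centre or b = centre}
-- of the strong product of two stars.  Two pigeonhole facts do all the work,
-- each using that k ≤ n cops cannot cover n + 1 distinct vertices:
--   * from (centre , b) the robber can step to every vertex (j , centre) of
--     the row through the centre, which again lies on C (symmetrically for
--     (a , centre) and the column), so some vertex of C is always free;
--   * (centre , b) has the n + 1 distinct neighbours (j , b'), for a fixed
--     b' adjacent to b, so the cops never surround a robber on C.

open import Defs
open import Data.Nat using (ℕ; _≤_; _+_; zero; suc; _<_)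
open import Data.Nat.Properties using (+-comm)
open import Data.Fin using (Fin; zero; suc)
open import Data.Fin.Properties using (_≟_; any?; all?; ¬∀⟶∃¬; pigeonhole; <⇒≢)
open import Data.Product using (∃; _×_; _,_; proj₁; proj₂)
open import Data.Product.Properties using (≡-dec)
open import Data.Sum using (_⊎_; inj₁; inj₂)
open import Data.Vec using (head)
open import Function.Definitions using (Injective)
open import Relation.Nullary using (¬_; Dec; yes; no; contradiction)
open import Relation.Nullary.Decidable using (_×-dec_; _⊎-dec_; ¬?; decidable-stable)
open import Relation.Binary.Definitions using (DecidableEquality)
open import Relation.Binary.PropositionalEquality using (_≡_; refl; sym; trans; cong; subst)

-- A type is searchable when existence of a witness of any decidable
-- predicate is decidable; finite types are, which lets the robber find a
-- legal move whenever there is one.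
Searchable : Set → Set₁
Searchable A = ∀ {P : A → Set} → (∀ a → Dec (P a)) → Dec (∃ P)

×-searchable : ∀ {A B : Set} → Searchable A → Searchable B → Searchable (A × B)
×-searchable searchA searchB P? with searchA (λ a → searchB (λ b → P? (a , b)))
... | yes (a , b , p) = yes ((a , b) , p)
... | no  ¬ab         = no λ { ((a , b) , p) → ¬ab (a , b , p) }

module RobberTactics (G : Graph) (k : ℕ) (_≟V_ : DecidableEquality (Graph.V G)) where
  open Graph G
  open Game G k hiding (CopsWin)

  occupied? : ∀ c v → Dec (Occupied c v)
  occupied? c v = any? (λ i → c i ≟V v)

  free-vertex : ∀ {m} → k < m → (f : Fin m → V) → Injective _≡_ _≡_ f →
                ∀ c → ∃ λ j → ¬ Occupied c (f j)
  free-vertex k<m f f-inj c with all? (λ j → occupied? c (f j))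
  ... | no ¬all = ¬∀⟶∃¬ _ (λ j → Occupied c (f j)) (λ j → occupied? c (f j)) ¬all
  ... | yes all with pigeonhole k<m (λ j → proj₁ (all j))
  ... | i , j , i<j , same-cop =
    contradiction (f-inj (trans (sym (proj₂ (all i))) (trans (cong c same-cop) (proj₂ (all j)))))
                  (<⇒≢ i<j)

  Escape : Cops → V → Set
  Escape c r = ∃ λ v → StepOrStay r v × ¬ Occupied c v

  -- On a searchable graph with decidable adjacency the robber is either
  -- surrounded or has a legal move; this covers positions off the territory.
  surrounded-or-escape : Searchable V → (∀ x y → Dec (Adj x y)) →
                         ∀ c r → Surrounded c r ⊎ Escape c r
  surrounded-or-escape search adj? c r
    with search (λ v → ((r ≟V v) ⊎-dec adj? r v) ×-dec ¬? (occupied? c v))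
  ... | yes escape = inj₂ escape
  ... | no ¬escape = inj₁ λ v r~v →
          decidable-stable (occupied? c v) (λ ¬occ → ¬escape (v , inj₂ r~v , ¬occ))

  record SafeTerritory : Set₁ where
    field
      Safe         : V → Set
      safe?        : ∀ v → Dec (Safe v)
      enter        : ∀ c → ∃ λ v → Safe v × ¬ Occupied c v
      keep         : ∀ c r → Safe r → ∃ λ v → Safe v × StepOrStay r v × ¬ Occupied c v
      unsurrounded : ∀ c r → Safe r → ¬ Surrounded c r

  module TerritoryRobber (legal : ∀ c r → Surrounded c r ⊎ Escape c r) (T : SafeTerritory) where
    open SafeTerritory T

    move : ∀ c r → Dec (Safe r) → V
    move c r (yes safe) = proj₁ (keep c r safe)
    move c r (no _) with legal c r
    ... | inj₁ _       = r
    ... | inj₂ (v , _) = v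

    move-legal : ∀ c r s → Surrounded c r ⊎ (StepOrStay r (move c r s) × ¬ Occupied c (move c r s))
    move-legal c r (yes safe) = inj₂ (proj₂ (proj₂ (keep c r safe)))
    move-legal c r (no _) with legal c r
    ... | inj₁ surrounded   = inj₁ surrounded
    ... | inj₂ (v , escape) = inj₂ escape

    move-safe : ∀ c r s → Safe r → Safe (move c r s)
    move-safe c r (yes safe) _    = proj₁ (proj₂ (keep c r safe))
    move-safe c r (no ¬safe) safe = contradiction safe ¬safe

    robber : RobberStrategy
    robber = record
      { start       = λ c → proj₁ (enter c)
      ; start-legal = λ c → proj₂ (proj₂ (enter c))
      ; move        = λ h c → move c (proj₂ (head h)) (safe? (proj₂ (head h)))
      ; move-legal  = λ h c → move-legal c (proj₂ (head h)) (safe? (proj₂ (head h)))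
      }

    always-safe : ∀ cops t → Safe (robberAt cops robber t)
    always-safe cops zero    = proj₁ (proj₂ (enter _))
    always-safe cops (suc t) =
      move-safe _ _ (safe? (robberAt cops robber t)) (always-safe cops t)

    territory-wins : ¬ Game.CopsWin G k
    territory-wins (cops , cops-win) with cops-win robber
    ... | t , inj₁ surrounded = unsurrounded _ _ (always-safe cops t) surrounded
    ... | t , inj₂ surrounded = unsurrounded _ _ (always-safe cops t) surrounded

from-centre : ∀ {n} (j : Fin (suc n)) → zero ≡ j ⊎ StarAdj zero j
from-centre zero    = inj₁ refl
from-centre (suc j) = inj₂ (inj₁ (refl , λ ()))

to-centre : ∀ {n} (j : Fin (suc n)) → j ≡ zero ⊎ StarAdj j zero
to-centre zero    = inj₁ refl
to-centre (suc j) = inj₂ (inj₂ ((λ ()) , refl))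

star-adj? : ∀ {n} (a b : Fin (suc n)) → Dec (StarAdj a b)
star-adj? a b = ((a ≟ zero) ×-dec ¬? (b ≟ zero)) ⊎-dec (¬? (a ≟ zero) ×-dec (b ≟ zero))

neighbour : ∀ {n} → Fin (suc (suc n)) → Fin (suc (suc n))
neighbour zero    = suc zero
neighbour (suc _) = zero

neighbour-adj : ∀ {n} (b : Fin (suc (suc n))) → StarAdj b (neighbour b)
neighbour-adj zero    = inj₁ (refl , λ ())
neighbour-adj (suc b) = inj₂ ((λ ()) , refl)

module Cross (n' k : ℕ) (k<n+1 : k < suc (suc n')) where
  n = suc n'
  G = StrongProduct (Star n) (Star n)
  open Graph G
  open Game G k hiding (CopsWin)

  _≟V_ : DecidableEquality V
  _≟V_ = ≡-dec _≟_ _≟_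

  open RobberTactics G k _≟V_

  adj? : ∀ x y → Dec (Adj x y)
  adj? (a , b) (a' , b') =
    ¬? ((a , b) ≟V (a' , b')) ×-dec (((a ≟ a') ⊎-dec star-adj? a a') ×-dec ((b ≟ b') ⊎-dec star-adj? b b'))

  step : ∀ {a b a' b'} → (a ≡ a' ⊎ StarAdj a a') → (b ≡ b' ⊎ StarAdj b b') →
         StepOrStay (a , b) (a' , b')
  step {a} {b} {a'} {b'} a→a' b→b' with (a , b) ≟V (a' , b')
  ... | yes same = inj₁ same
  ... | no  diff = inj₂ (diff , a→a' , b→b')

  OnCross : V → Set
  OnCross (a , b) = a ≡ zero ⊎ b ≡ zero

  row column : Fin (suc n) → V
  row    j = (j , zero)
  column j = (zero , j)

  -- From (centre , b) the robber can step to any vertex of the row, from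
  -- (a , centre) to any vertex of the column; one of them is free.
  keep-on-cross : ∀ c r → OnCross r → ∃ λ v → OnCross v × StepOrStay r v × ¬ Occupied c v
  keep-on-cross c (.zero , b) (inj₁ refl) =
    let (j , free) = free-vertex k<n+1 row (cong proj₁) c
    in row j , inj₂ refl , step (from-centre j) (to-centre b) , free
  keep-on-cross c (a , .zero) (inj₂ refl) =
    let (j , free) = free-vertex k<n+1 column (cong proj₂) c
    in column j , inj₁ refl , step (to-centre a) (from-centre j) , free

  -- (centre , b) is adjacent to the n + 1 vertices (j , neighbour b), which
  -- the cops cannot all occupy; symmetrically for (a , centre).
  cross-unsurrounded : ∀ c r → OnCross r → ¬ Surrounded c r
  cross-unsurrounded c (.zero , b) (inj₁ refl) surrounded =
    let (j , free) = free-vertex k<n+1 (λ j → (j , neighbour b)) (cong proj₁) c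
        moved : ¬ (zero , b) ≡ (j , neighbour b)
        moved e = Graph.Adj-irrefl (Star n) (subst (StarAdj b) (sym (cong proj₂ e)) (neighbour-adj b))
    in free (surrounded (j , neighbour b) (moved , from-centre j , inj₂ (neighbour-adj b)))
  cross-unsurrounded c (a , .zero) (inj₂ refl) surrounded =
    let (j , free) = free-vertex k<n+1 (λ j → (neighbour a , j)) (cong proj₂) c
        moved : ¬ (a , zero) ≡ (neighbour a , j)
        moved e = Graph.Adj-irrefl (Star n) (subst (StarAdj a) (sym (cong proj₁ e)) (neighbour-adj a))
    in free (surrounded (neighbour a , j) (moved , inj₂ (neighbour-adj a) , from-centre j))

  cross : SafeTerritory
  cross = record
    { Safe         = OnCross
    ; safe?        = λ { (a , b) → (a ≟ zero) ⊎-dec (b ≟ zero) }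
    ; enter        = λ c → let (j , free) = free-vertex k<n+1 row (cong proj₁) c
                           in row j , inj₂ refl , free
    ; keep         = keep-on-cross
    ; unsurrounded = cross-unsurrounded
    }

  robber-wins : ¬ CopsWin G k
  robber-wins = TerritoryRobber.territory-wins
    (surrounded-or-escape (×-searchable any? any?) adj?) cross

theorem20 : ∀ (n : ℕ) → 1 ≤ n →
    SurroundingCopNumber≥ (StrongProduct (Star n) (Star n)) (n + 1)
theorem20 (suc n') _ k _ k<n+1 = Cross.robber-wins n' k (subst (k <_) (+-comm (suc n') 1) k<n+1)
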